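{- Let $m\ge2$ and $t\ge1$ be integers, and let $f_2$ be the reduced two-digit Kaprekar map on $X_m=\{0,1,\dots,m\}$. Put $g_+=\gcd(m+1,2^t+1)$ and $g_-=\gcd(m+1,2^t-1)$. Then the set of nonzero $a\in X_m$ with $f_2^t(a)=a$ equals $$\Big\{a\in X_m : a=\tfrac{m+1}{g_+}\,\xi_1,\ \xi_1 \text{ odd},\ 1\le\xi_1\le g_+\Big\}\ \cup\ \Big\{a\in X_m : a=\tfrac{m+1}{g_- }\,\xi_2,\ \xi_2 \text{ odd},\ 1\le\xi_2\le g_-\Big\}.$$
   Context: Let $X=\{0,1,\dots,m^2-1\}$, each element written with two base-$m$ digits $x=d_1m+d_0$ (leading zeros allowed). Let $f(x)=\big(m\max(d_0,d_1)+\min(d_0,d_1)\big)-\big(m\min(d_0,d_1)+\max(d_0,d_1)\big)=(m-1)|d_1-d_0|$. The reduced map $f_2:X_m\to X_m$ is $f_2(a)=f(a(m-1))/(m-1)$. Concretely, $f_2(0)=0$ and $f_2(a)=|2a-m-1|$ for $1\le a\le m$. $f_2^t$ denotes the $t$-fold iterate. -}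

module Defs where

open import Data.Nat using (ℕ; zero; suc; _+_; _*_; _^_; _∸_; ∣_-_∣; NonZero; ≢-nonZero)
open import Data.Nat.GCD using (gcd; gcd[m,n]≢0)
open import Data.Nat.DivMod using (_/_)
open import Data.Sum using (inj₁)

f₂ : ℕ → ℕ → ℕ
f₂ m zero = zero
f₂ m (suc a) = ∣ 2 * suc a - suc m ∣

iter : ℕ → (ℕ → ℕ) → ℕ → ℕ
iter zero f x = x
iter (suc t) f x = f (iter t f x)

g₊ : ℕ → ℕ → ℕ
g₊ m t = gcd (suc m) (2 ^ t + 1)

g₋ : ℕ → ℕ → ℕ
g₋ m t = gcd (suc m) (2 ^ t ∸ 1)

cofactor : ℕ → ℕ → ℕ
cofactor m n = _/_ (suc m) (gcd (suc m) n) {{≢-nonZero (gcd[m,n]≢0 (suc m) n (inj₁ λ ()))}}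

Odd : ℕ → Set
Odd ξ = ∃ (λ k → ξ ≡ 2 * k + 1)
  where open import Data.Product using (∃)
        open import Relation.Binary.PropositionalEquality using (_≡_)

-- Away from its fixed point 0 the map is x ↦ ±(2x − (m+1)), so every nonzero iterate
-- satisfies f₂ᵗ(a) = ±2ᵗa + (odd)·(m+1).  A nonzero t-periodic point therefore has
-- a(2ᵗ ± 1) = (odd)·(m+1); dividing by g = gcd(m+1, 2ᵗ ± 1) and using that (m+1)/g and
-- (2ᵗ ± 1)/g are coprime gives a = ((m+1)/g)·ξ with ξ odd and ξ ≤ g.
-- Conversely such an a is the (m+1)/g-fold scaling of the point ξ of f₂ on X_{g−1}.
-- There g is odd, all iterates of ξ stay odd and below g, and the same identity with
-- 2ᵗ = (odd)·g ∓ 1 gives f₂ᵗ(ξ) ≡ ±ξ (mod 2g), which forces f₂ᵗ(ξ) = ξ.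

module Submission where

open import Defs
open import Data.Nat using (ℕ; _+_; _*_; _^_; _∸_; _≤_; _≥_)
open import Data.Product using (Σ; ∃; _×_; _,_)
open import Data.Sum using (_⊎_)
open import Function.Bundles using (_⇔_)
open import Relation.Binary.PropositionalEquality using (_≡_)

open import Data.Nat using (zero; suc; pred; _<_; z≤n; s≤s; ∣_-_∣; NonZero; ≢-nonZero; >-nonZero⁻¹)
open import Data.Nat.Properties
open import Data.Nat.Divisibility using (_∣_; divides; >⇒∤; m∣n*o⇒m/n∣o)
open import Data.Nat.DivMod using (_/_; m/n*n≡m)
open import Data.Nat.GCD using (gcd; gcd[m,n]≢0; gcd[m,n]∣m; gcd[m,n]∣n; m/gcd[m,n]≢0)
open import Data.Nat.Coprimality using (coprime-/gcd; coprime-divisor)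
import Data.Nat.Tactic.RingSolver as ℕ-Solver
open import Data.Integer as ℤ using (ℤ; +_; -[1+_]; _⊖_)
import Data.Integer.Properties as ℤ
open import Data.Integer.Divisibility.Signed using (∣⇒∣ᵤ) renaming (_∣_ to _∣ℤ_; divides to dividesℤ)
open import Data.Integer.Tactic.RingSolver using (solve-∀)
open import Data.Sign using (Sign)
open import Data.Product using (∃₂; proj₁; proj₂)
open import Data.Sum using (inj₁; inj₂)
import Data.Sum as Sum
open import Data.Empty using (⊥-elim)
open import Function.Bundles using (mk⇔)
open import Function using (_∘_)
open import Relation.Nullary using (¬_; contradiction)
open import Relation.Binary.PropositionalEquality using (_≢_; refl; sym; trans; cong; cong₂; subst₂; subst; module ≡-Reasoning)

open ≡-Reasoning

even-or-odd : ∀ n → (∃ λ j → n ≡ 2 * j) ⊎ Odd n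
even-or-odd zero = inj₁ (0 , refl)
even-or-odd (suc zero) = inj₂ (0 , refl)
even-or-odd (suc (suc n)) with even-or-odd n
... | inj₁ (j , refl) = inj₁ (suc j , sym (*-suc 2 j))
... | inj₂ (j , refl) = inj₂ (suc j , cong (_+ 1) (sym (*-suc 2 j)))

odd-*⇒oddˡ : ∀ x y → Odd (x * y) → Odd x
odd-*⇒oddˡ x y (k , xy≡2k+1) with even-or-odd x
... | inj₂ odd-x = odd-x
... | inj₁ (j , refl) =
  ⊥-elim (even≢odd (j * y) k (trans (sym (*-assoc 2 j y)) (trans xy≡2k+1 (+-comm (2 * k) 1))))

odd-*⇒oddʳ : ∀ x y → Odd (x * y) → Odd y
odd-*⇒oddʳ x y odd-xy = odd-*⇒oddˡ y x (subst Odd (*-comm x y) odd-xy)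

odd⇒1≤ : ∀ {x} → Odd x → 1 ≤ x
odd⇒1≤ (k , refl) = m≤n+m 1 (2 * k)

odd-2k∸1 : ∀ {k} → 1 ≤ k → Odd (2 * k ∸ 1)
odd-2k∸1 {suc k} _ = k , trans (cong (_∸ 1) (*-suc 2 k)) (+-comm 1 (2 * k))

odd-∣2k-odd∣ : ∀ k h → Odd ∣ 2 * k - (2 * h + 1) ∣
odd-∣2k-odd∣ zero h = h , refl
odd-∣2k-odd∣ (suc k) zero = k , trans (cong (λ z → ∣ z - 1 ∣) (*-suc 2 k)) (+-comm 1 (2 * k))
odd-∣2k-odd∣ (suc k) (suc h) =
  subst Odd (cong₂ (λ u v → ∣ u - v + 1 ∣) (sym (*-suc 2 k)) (sym (*-suc 2 h))) (odd-∣2k-odd∣ k h)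

signed : Sign → ℤ → ℤ
signed Sign.+ x = x
signed Sign.- x = ℤ.- x

oddℤ : ℤ → ℤ
oddℤ k = + 2 ℤ.* k ℤ.+ + 1

+-oddℤ : ∀ k → + (2 * k + 1) ≡ oddℤ (+ k)
+-oddℤ k = cong (ℤ._+ + 1) (ℤ.pos-* 2 k)

Odd⇒oddℤ : ∀ {x} → Odd x → ∃ λ j → + x ≡ oddℤ j
Odd⇒oddℤ (k , refl) = + k , +-oddℤ k

OddShifted : ℤ → ℤ → ℤ → Set
OddShifted n y x = ∃₂ λ s k → x ≡ signed s y ℤ.+ oddℤ k ℤ.* n

oddℤ-multiple⇒odd-multiple : ∀ A N k → + A ≡ oddℤ k ℤ.* + suc N →
                             ∃ λ K → Odd K × A ≡ K * suc N
oddℤ-multiple⇒odd-multiple A N (+ K) A≡ =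
  2 * K + 1 , (K , refl) ,
  ℤ.+-injective (trans A≡ (sym (trans (ℤ.pos-* (2 * K + 1) (suc N)) (cong (ℤ._* + suc N) (+-oddℤ K)))))
oddℤ-multiple⇒odd-multiple A N -[1+ j ] A≡ with trans A≡ (trans (negative (+ j) (+ suc N)) (cong ℤ.-_ (sym pos)))
  where
  negative : ∀ J M → (+ 2 ℤ.* ℤ.- (+ 1 ℤ.+ J) ℤ.+ + 1) ℤ.* M ≡ ℤ.- ((+ 1 ℤ.+ + 2 ℤ.* J) ℤ.* M)
  negative = solve-∀
  pos : + (suc (2 * j) * suc N) ≡ (+ 1 ℤ.+ + 2 ℤ.* + j) ℤ.* + suc N
  pos = trans (ℤ.pos-* (suc (2 * j)) (suc N)) (cong (λ z → (+ 1 ℤ.+ z) ℤ.* + suc N) (ℤ.pos-* 2 j))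
... | ()

∣+p-+q∣≡∣p-q∣ : ∀ p q → ℤ.∣ + p ℤ.- + q ∣ ≡ ∣ p - q ∣
∣+p-+q∣≡∣p-q∣ p q with ≤-total p q
... | inj₁ p≤q = trans (cong ℤ.∣_∣ (ℤ.m-n≡m⊖n p q)) (trans (ℤ.∣⊖∣-≤ p≤q) (sym (m≤n⇒∣m-n∣≡n∸m p≤q)))
... | inj₂ q≤p = begin
  ℤ.∣ + p ℤ.- + q ∣ ≡⟨ cong ℤ.∣_∣ (ℤ.m-n≡m⊖n p q) ⟩
  ℤ.∣ p ⊖ q ∣       ≡⟨ ℤ.∣m⊖n∣≡∣n⊖m∣ p q ⟩
  ℤ.∣ q ⊖ p ∣       ≡⟨ ℤ.∣⊖∣-≤ q≤p ⟩
  p ∸ q             ≡⟨ m≤n⇒∣n-m∣≡n∸m q≤p ⟨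
  ∣ p - q ∣         ∎

+∣p-q∣≡±[p-q] : ∀ p q → ∃ λ s → + ∣ p - q ∣ ≡ signed s (+ p ℤ.- + q)
+∣p-q∣≡±[p-q] p q with ℤ.+∣i∣≡i⊎+∣i∣≡-i (+ p ℤ.- + q)
... | inj₁ eq = Sign.+ , trans (cong +_ (sym (∣+p-+q∣≡∣p-q∣ p q))) eq
... | inj₂ eq = Sign.- , trans (cong +_ (sym (∣+p-+q∣≡∣p-q∣ p q))) eq

∣∧<⇒≡0 : ∀ {n x} → n ∣ x → x < n → x ≡ 0
∣∧<⇒≡0 {x = zero} _ _ = refl
∣∧<⇒≡0 {x = suc _} n∣x x<n = contradiction n∣x (>⇒∤ x<n)

+n∣+p-+q⇒p≡q : ∀ {n p q} → p < n → q < n → + n ∣ℤ + p ℤ.- + q → p ≡ q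
+n∣+p-+q⇒p≡q {n} {p} {q} p<n q<n n∣p-q = ∣m-n∣≡0⇒m≡n (∣∧<⇒≡0 n∣∣p-q∣ ∣p-q∣<n)
  where
  n∣∣p-q∣ : n ∣ ∣ p - q ∣
  n∣∣p-q∣ = subst (n ∣_) (∣+p-+q∣≡∣p-q∣ p q) (∣⇒∣ᵤ n∣p-q)
  ∣p-q∣<n : ∣ p - q ∣ < n
  ∣p-q∣<n = ≤-<-trans (∣m-n∣≤m⊔n p q) (⊔-lub p<n q<n)

+n∤+p++q : ∀ {n p q} → 1 ≤ p → p + q < n → ¬ (+ n ∣ℤ + p ℤ.+ + q)
+n∤+p++q {p = suc _} _ p+q<n n∣p+q with ∣∧<⇒≡0 (∣⇒∣ᵤ n∣p+q) p+q<n
... | ()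

f₂-≢0 : ∀ m {x} → x ≢ 0 → f₂ m x ≡ ∣ 2 * x - suc m ∣
f₂-≢0 m {zero} x≢0 = contradiction refl x≢0
f₂-≢0 m {suc x} _ = refl

f₂-≤ : ∀ m {a} → a ≤ m → f₂ m a ≤ m
f₂-≤ m {zero} _ = z≤n
f₂-≤ m {suc a} a<m with ≤-total (2 * suc a) (suc m)
... | inj₁ 2a≤N = subst (_≤ m) (sym (m≤n⇒∣m-n∣≡n∸m 2a≤N)) (∸-monoʳ-≤ {m = 1} {n = 2 * suc a} (suc m) (s≤s z≤n))
... | inj₂ N≤2a = subst (_≤ m) (sym (m≤n⇒∣n-m∣≡n∸m N≤2a)) (m≤n+o⇒m∸n≤o (2 * suc a) (suc m) 2a≤N+m)
  where
  2a≤N+m : 2 * suc a ≤ suc m + m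
  2a≤N+m = ≤-trans (*-monoʳ-≤ 2 a<m) (+-mono-≤ (n≤1+n m) (≤-reflexive (+-identityʳ m)))

f₂-odd : ∀ {m a} → Odd (suc m) → Odd a → Odd (f₂ m a)
f₂-odd {m} {a} (h , N≡2h+1) odd-a = subst Odd (sym f₂a≡) (odd-∣2k-odd∣ a h)
  where
  f₂a≡ : f₂ m a ≡ ∣ 2 * a - (2 * h + 1) ∣
  f₂a≡ = trans (f₂-≢0 m (n>0⇒n≢0 (odd⇒1≤ odd-a))) (cong (λ N → ∣ 2 * a - N ∣) N≡2h+1)

f₂-* : ∀ {m m′ c} → c * suc m′ ≡ suc m → ∀ x → f₂ m (c * x) ≡ c * f₂ m′ x
f₂-* {c = c} _ zero rewrite *-zeroʳ c = refl
f₂-* {m} {m′} {suc c} c[1+m′]≡1+m (suc x) = begin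
  f₂ m (suc c * suc x)                   ≡⟨⟩
  ∣ 2 * (suc c * suc x) - suc m ∣         ≡⟨ cong (λ N → ∣ 2 * (suc c * suc x) - N ∣) (sym c[1+m′]≡1+m) ⟩
  ∣ 2 * (suc c * suc x) - suc c * suc m′ ∣ ≡⟨ cong (λ y → ∣ y - suc c * suc m′ ∣) (swap-2 (suc c) (suc x)) ⟩
  ∣ suc c * (2 * suc x) - suc c * suc m′ ∣ ≡⟨ *-distribˡ-∣-∣ (suc c) (2 * suc x) (suc m′) ⟨
  suc c * f₂ m′ (suc x)                   ∎
  where
  swap-2 : ∀ c x → 2 * (c * x) ≡ c * (2 * x)
  swap-2 = ℕ-Solver.solve-∀

iter-* : ∀ {f g : ℕ → ℕ} c → (∀ x → f (c * x) ≡ c * g x) → ∀ t x → iter t f (c * x) ≡ c * iter t g x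
iter-* c f∘c≡c∘g zero x = refl
iter-* {f} {g} c f∘c≡c∘g (suc t) x = trans (cong f (iter-* c f∘c≡c∘g t x)) (f∘c≡c∘g (iter t g x))

iter-preserves : ∀ (P : ℕ → Set) {f} → (∀ x → P x → P (f x)) → ∀ t x → P x → P (iter t f x)
iter-preserves P f-pres zero x Px = Px
iter-preserves P {f} f-pres (suc t) x Px = f-pres (iter t f x) (iter-preserves P f-pres t x Px)

-- The ring solver does not unfold signed or oddℤ, so the identities below are spelled out.
double-shift : ∀ s′ s y k N → ∃₂ λ s″ k′ →
  signed s′ (+ 2 ℤ.* (signed s y ℤ.+ k ℤ.* N) ℤ.- N) ≡ signed s″ (+ 2 ℤ.* y) ℤ.+ oddℤ k′ ℤ.* N
double-shift Sign.+ Sign.+ y k N = Sign.+ , k ℤ.- + 1 , ring y k N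
  where
  ring : ∀ y k N → + 2 ℤ.* (y ℤ.+ k ℤ.* N) ℤ.- N ≡ + 2 ℤ.* y ℤ.+ (+ 2 ℤ.* (k ℤ.- + 1) ℤ.+ + 1) ℤ.* N
  ring = solve-∀
double-shift Sign.+ Sign.- y k N = Sign.- , k ℤ.- + 1 , ring y k N
  where
  ring : ∀ y k N → + 2 ℤ.* (ℤ.- y ℤ.+ k ℤ.* N) ℤ.- N ≡ ℤ.- (+ 2 ℤ.* y) ℤ.+ (+ 2 ℤ.* (k ℤ.- + 1) ℤ.+ + 1) ℤ.* N
  ring = solve-∀
double-shift Sign.- Sign.+ y k N = Sign.- , ℤ.- k , ring y k N
  where
  ring : ∀ y k N → ℤ.- (+ 2 ℤ.* (y ℤ.+ k ℤ.* N) ℤ.- N) ≡ ℤ.- (+ 2 ℤ.* y) ℤ.+ (+ 2 ℤ.* ℤ.- k ℤ.+ + 1) ℤ.* N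
  ring = solve-∀
double-shift Sign.- Sign.- y k N = Sign.+ , ℤ.- k , ring y k N
  where
  ring : ∀ y k N → ℤ.- (+ 2 ℤ.* (ℤ.- y ℤ.+ k ℤ.* N) ℤ.- N) ≡ + 2 ℤ.* y ℤ.+ (+ 2 ℤ.* ℤ.- k ℤ.+ + 1) ℤ.* N
  ring = solve-∀

f₂-oddShifted : ∀ m {x y} s k → x ≢ 0 → + x ≡ signed s y ℤ.+ k ℤ.* + suc m →
                OddShifted (+ suc m) (+ 2 ℤ.* y) (+ f₂ m x)
f₂-oddShifted m {x} {y} s k x≢0 x≡ with +∣p-q∣≡±[p-q] (2 * x) (suc m)
... | s′ , f₂x≡ with double-shift s′ s y k (+ suc m)
... | s″ , k′ , shifted = s″ , k′ , (begin
  + f₂ m x                                             ≡⟨ cong +_ (f₂-≢0 m x≢0) ⟩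
  + ∣ 2 * x - suc m ∣                                  ≡⟨ f₂x≡ ⟩
  signed s′ (+ (2 * x) ℤ.- + suc m)                    ≡⟨ cong (λ z → signed s′ (z ℤ.- + suc m)) (ℤ.pos-* 2 x) ⟩
  signed s′ (+ 2 ℤ.* + x ℤ.- + suc m)                  ≡⟨ cong (λ z → signed s′ (+ 2 ℤ.* z ℤ.- + suc m)) x≡ ⟩
  signed s′ (+ 2 ℤ.* (signed s y ℤ.+ k ℤ.* + suc m) ℤ.- + suc m) ≡⟨ shifted ⟩
  signed s″ (+ 2 ℤ.* y) ℤ.+ oddℤ k′ ℤ.* + suc m        ∎)

iter-f₂-oddShifted : ∀ m u a → iter (suc u) (f₂ m) a ≢ 0 →
                     OddShifted (+ suc m) (+ (2 ^ suc u) ℤ.* + a) (+ iter (suc u) (f₂ m) a)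
iter-f₂-oddShifted m zero a f₂a≢0 = f₂-oddShifted m Sign.+ (+ 0) (f₂a≢0 ∘ cong (f₂ m)) (x≡x+0*N (+ a) (+ suc m))
  where
  x≡x+0*N : ∀ x N → x ≡ x ℤ.+ + 0 ℤ.* N
  x≡x+0*N = solve-∀
iter-f₂-oddShifted m (suc u) a f₂x≢0 with iter-f₂-oddShifted m u a (f₂x≢0 ∘ cong (f₂ m))
... | s , k , x≡ =
  subst (λ y → OddShifted (+ suc m) y (+ iter (suc (suc u)) (f₂ m) a)) 2*2^t≡2^[1+t] (f₂-oddShifted m s (oddℤ k) (f₂x≢0 ∘ cong (f₂ m)) x≡)
  where
  2*2^t≡2^[1+t] : + 2 ℤ.* (+ (2 ^ suc u) ℤ.* + a) ≡ + (2 ^ suc (suc u)) ℤ.* + a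
  2*2^t≡2^[1+t] = trans (sym (ℤ.*-assoc (+ 2) (+ (2 ^ suc u)) (+ a))) (cong (ℤ._* + a) (sym (ℤ.pos-* 2 (2 ^ suc u))))

fixed-point⁻ : ∀ {A Q} n P → A ≡ ℤ.- (P ℤ.* A) ℤ.+ Q → P ≡ n ℤ.- + 1 → A ℤ.* n ≡ Q
fixed-point⁻ {A} {Q} n _ A≡ refl = begin
  A ℤ.* n                                        ≡⟨ ring₁ A n ⟩
  A ℤ.+ (n ℤ.- + 1) ℤ.* A                        ≡⟨ cong (ℤ._+ (n ℤ.- + 1) ℤ.* A) A≡ ⟩
  ℤ.- ((n ℤ.- + 1) ℤ.* A) ℤ.+ Q ℤ.+ (n ℤ.- + 1) ℤ.* A ≡⟨ ring₂ ((n ℤ.- + 1) ℤ.* A) Q ⟩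
  Q                                              ∎
  where
  ring₁ : ∀ A n → A ℤ.* n ≡ A ℤ.+ (n ℤ.- + 1) ℤ.* A
  ring₁ = solve-∀
  ring₂ : ∀ X Q → ℤ.- X ℤ.+ Q ℤ.+ X ≡ Q
  ring₂ = solve-∀

fixed-point⁺ : ∀ {A Q} n P → A ≡ P ℤ.* A ℤ.+ Q → P ≡ n ℤ.+ + 1 → A ℤ.* n ≡ ℤ.- Q
fixed-point⁺ {A} {Q} n _ A≡ refl = begin
  A ℤ.* n                                        ≡⟨ ring₁ A n ⟩
  (n ℤ.+ + 1) ℤ.* A ℤ.- A                        ≡⟨ cong (λ z → (n ℤ.+ + 1) ℤ.* A ℤ.- z) A≡ ⟩
  (n ℤ.+ + 1) ℤ.* A ℤ.- ((n ℤ.+ + 1) ℤ.* A ℤ.+ Q) ≡⟨ ring₂ ((n ℤ.+ + 1) ℤ.* A) Q ⟩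
  ℤ.- Q                                          ∎
  where
  ring₁ : ∀ A n → A ℤ.* n ≡ (n ℤ.+ + 1) ℤ.* A ℤ.- A
  ring₁ = solve-∀
  ring₂ : ∀ X Q → X ℤ.- (X ℤ.+ Q) ≡ ℤ.- Q
  ring₂ = solve-∀

neg-oddℤ : ∀ k N → ℤ.- (oddℤ k ℤ.* N) ≡ oddℤ (ℤ.- k ℤ.- + 1) ℤ.* N
neg-oddℤ = ring
  where
  ring : ∀ k N → ℤ.- ((+ 2 ℤ.* k ℤ.+ + 1) ℤ.* N) ≡ (+ 2 ℤ.* (ℤ.- k ℤ.- + 1) ℤ.+ + 1) ℤ.* N
  ring = solve-∀

+p≡+[p+1]-1 : ∀ p → + p ≡ + (p + 1) ℤ.- + 1
+p≡+[p+1]-1 p = trans (ring (+ p)) (cong (ℤ._- + 1) (sym (ℤ.pos-+ p 1)))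
  where
  ring : ∀ x → x ≡ x ℤ.+ + 1 ℤ.- + 1
  ring = solve-∀

+p≡+[p∸1]+1 : ∀ {p} → 1 ≤ p → + p ≡ + (p ∸ 1) ℤ.+ + 1
+p≡+[p∸1]+1 {p} 1≤p = trans (ring (+ p)) (cong (ℤ._+ + 1) (trans (ℤ.m-n≡m⊖n p 1) (ℤ.⊖-≥ 1≤p)))
  where
  ring : ∀ x → x ≡ x ℤ.- + 1 ℤ.+ + 1
  ring = solve-∀

periodic⇒odd-multiple : ∀ m u a → 1 ≤ a → iter (suc u) (f₂ m) a ≡ a →
  (∃ λ K → Odd K × a * (2 ^ suc u + 1) ≡ K * suc m) ⊎ (∃ λ K → Odd K × a * (2 ^ suc u ∸ 1) ≡ K * suc m)
periodic⇒odd-multiple m u a 1≤a fix with iter-f₂-oddShifted m u a (subst (_≢ 0) (sym fix) (n>0⇒n≢0 1≤a))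
... | Sign.- , k , x≡ = inj₁ (oddℤ-multiple⇒odd-multiple _ m k (trans (ℤ.pos-* a _)
        (fixed-point⁻ _ _ (trans (cong +_ (sym fix)) x≡) (+p≡+[p+1]-1 (2 ^ suc u)))))
... | Sign.+ , k , x≡ = inj₂ (oddℤ-multiple⇒odd-multiple _ m (ℤ.- k ℤ.- + 1) (trans (ℤ.pos-* a _)
        (trans (fixed-point⁺ _ _ (trans (cong +_ (sym fix)) x≡) (+p≡+[p∸1]+1 (m^n>0 2 (suc u)))) (neg-oddℤ k (+ suc m)))))

oddShifted-collapse : ∀ {G D P X η} → (∃ λ e → D ≡ oddℤ e) → (∃ λ j → X ≡ oddℤ j) →
  P ≡ D ℤ.* G ℤ.- + 1 ⊎ P ≡ D ℤ.* G ℤ.+ + 1 → OddShifted G (P ℤ.* X) η →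
  (+ 2 ℤ.* G ∣ℤ η ℤ.- X) ⊎ (+ 2 ℤ.* G ∣ℤ η ℤ.+ X)
oddShifted-collapse {G} (e , refl) (j , refl) (inj₁ refl) (Sign.+ , k , refl) =
  inj₂ (dividesℤ (+ 2 ℤ.* e ℤ.* j ℤ.+ e ℤ.+ j ℤ.+ k ℤ.+ + 1) (ring e j k G))
  where
  ring : ∀ e j k G →
    ((+ 2 ℤ.* e ℤ.+ + 1) ℤ.* G ℤ.- + 1) ℤ.* (+ 2 ℤ.* j ℤ.+ + 1) ℤ.+ (+ 2 ℤ.* k ℤ.+ + 1) ℤ.* G ℤ.+ (+ 2 ℤ.* j ℤ.+ + 1)
    ≡ (+ 2 ℤ.* e ℤ.* j ℤ.+ e ℤ.+ j ℤ.+ k ℤ.+ + 1) ℤ.* (+ 2 ℤ.* G)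
  ring = solve-∀
oddShifted-collapse {G} (e , refl) (j , refl) (inj₁ refl) (Sign.- , k , refl) =
  inj₁ (dividesℤ (k ℤ.- + 2 ℤ.* e ℤ.* j ℤ.- e ℤ.- j) (ring e j k G))
  where
  ring : ∀ e j k G →
    ℤ.- (((+ 2 ℤ.* e ℤ.+ + 1) ℤ.* G ℤ.- + 1) ℤ.* (+ 2 ℤ.* j ℤ.+ + 1)) ℤ.+ (+ 2 ℤ.* k ℤ.+ + 1) ℤ.* G ℤ.- (+ 2 ℤ.* j ℤ.+ + 1)
    ≡ (k ℤ.- + 2 ℤ.* e ℤ.* j ℤ.- e ℤ.- j) ℤ.* (+ 2 ℤ.* G)
  ring = solve-∀
oddShifted-collapse {G} (e , refl) (j , refl) (inj₂ refl) (Sign.+ , k , refl) =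
  inj₁ (dividesℤ (+ 2 ℤ.* e ℤ.* j ℤ.+ e ℤ.+ j ℤ.+ k ℤ.+ + 1) (ring e j k G))
  where
  ring : ∀ e j k G →
    ((+ 2 ℤ.* e ℤ.+ + 1) ℤ.* G ℤ.+ + 1) ℤ.* (+ 2 ℤ.* j ℤ.+ + 1) ℤ.+ (+ 2 ℤ.* k ℤ.+ + 1) ℤ.* G ℤ.- (+ 2 ℤ.* j ℤ.+ + 1)
    ≡ (+ 2 ℤ.* e ℤ.* j ℤ.+ e ℤ.+ j ℤ.+ k ℤ.+ + 1) ℤ.* (+ 2 ℤ.* G)
  ring = solve-∀
oddShifted-collapse {G} (e , refl) (j , refl) (inj₂ refl) (Sign.- , k , refl) =
  inj₂ (dividesℤ (k ℤ.- + 2 ℤ.* e ℤ.* j ℤ.- e ℤ.- j) (ring e j k G))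
  where
  ring : ∀ e j k G →
    ℤ.- (((+ 2 ℤ.* e ℤ.+ + 1) ℤ.* G ℤ.+ + 1) ℤ.* (+ 2 ℤ.* j ℤ.+ + 1)) ℤ.+ (+ 2 ℤ.* k ℤ.+ + 1) ℤ.* G ℤ.+ (+ 2 ℤ.* j ℤ.+ + 1)
    ≡ (k ℤ.- + 2 ℤ.* e ℤ.* j ℤ.- e ℤ.- j) ℤ.* (+ 2 ℤ.* G)
  ring = solve-∀

odd-fixed-point : ∀ m′ u n d → Odd n → n ≡ d * suc m′ →
  + (2 ^ suc u) ≡ + n ℤ.- + 1 ⊎ + (2 ^ suc u) ≡ + n ℤ.+ + 1 →
  ∀ {ξ} → Odd ξ → ξ ≤ m′ → iter (suc u) (f₂ m′) ξ ≡ ξ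
odd-fixed-point m′ u n d odd-n n≡dg 2^t≡n∓1 {ξ} odd-ξ ξ≤m′ =
  Sum.[ (λ 2g∣η-ξ → +n∣+p-+q⇒p≡q η<2g ξ<2g (subst (_∣ℤ + η ℤ.- + ξ) 2g≡ 2g∣η-ξ))
      , (λ 2g∣η+ξ → contradiction (subst (_∣ℤ + η ℤ.+ + ξ) 2g≡ 2g∣η+ξ) (+n∤+p++q (odd⇒1≤ odd-η) η+ξ<2g)) ]′
    (oddShifted-collapse (Odd⇒oddℤ odd-d) (Odd⇒oddℤ odd-ξ) 2^t≡dg∓1 (iter-f₂-oddShifted m′ u ξ (n>0⇒n≢0 (odd⇒1≤ odd-η))))
  where
  g = suc m′
  η = iter (suc u) (f₂ m′) ξ
  odd-dg : Odd (d * g)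
  odd-dg = subst Odd n≡dg odd-n
  odd-d : Odd d
  odd-d = odd-*⇒oddˡ d g odd-dg
  odd-g : Odd g
  odd-g = odd-*⇒oddʳ d g odd-dg
  odd-η×η≤m′ : Odd η × η ≤ m′
  odd-η×η≤m′ = iter-preserves (λ x → Odd x × x ≤ m′) (λ x (odd-x , x≤m′) → f₂-odd odd-g odd-x , f₂-≤ m′ x≤m′)
                              (suc u) ξ (odd-ξ , ξ≤m′)
  odd-η = proj₁ odd-η×η≤m′
  η≤m′ = proj₂ odd-η×η≤m′
  2^t≡dg∓1 : + (2 ^ suc u) ≡ + d ℤ.* + g ℤ.- + 1 ⊎ + (2 ^ suc u) ≡ + d ℤ.* + g ℤ.+ + 1
  2^t≡dg∓1 = Sum.map (λ e → trans e (cong (ℤ._- + 1) +n≡)) (λ e → trans e (cong (ℤ._+ + 1) +n≡)) 2^t≡n∓1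
    where
    +n≡ : + n ≡ + d ℤ.* + g
    +n≡ = trans (cong +_ n≡dg) (ℤ.pos-* d g)
  2g≡ : + 2 ℤ.* + g ≡ + (2 * g)
  2g≡ = sym (ℤ.pos-* 2 g)
  η<2g : η < 2 * g
  η<2g = ≤-trans (s≤s η≤m′) (m≤m+n g (g + 0))
  ξ<2g : ξ < 2 * g
  ξ<2g = ≤-trans (s≤s ξ≤m′) (m≤m+n g (g + 0))
  η+ξ<2g : η + ξ < 2 * g
  η+ξ<2g = subst (η + ξ <_) (cong (λ x → g + x) (sym (+-identityʳ g))) (+-mono-< (s≤s η≤m′) (s≤s ξ≤m′))

module _ (m n : ℕ) where

  private instance
    gcd-nonZero : NonZero (gcd (suc m) n)
    gcd-nonZero = ≢-nonZero (gcd[m,n]≢0 (suc m) n (inj₁ λ ()))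

    cofactor-nonZero : NonZero (cofactor m n)
    cofactor-nonZero = ≢-nonZero (m/gcd[m,n]≢0 (suc m) n)

  cofactor*gcd≡1+m : cofactor m n * gcd (suc m) n ≡ suc m
  cofactor*gcd≡1+m = m/n*n≡m (gcd[m,n]∣m (suc m) n)

  n/gcd*gcd≡n : n / gcd (suc m) n * gcd (suc m) n ≡ n
  n/gcd*gcd≡n = m/n*n≡m (gcd[m,n]∣n (suc m) n)

  cofactor-∣ : ∀ {a} → suc m ∣ a * n → cofactor m n ∣ a
  cofactor-∣ {a} 1+m∣an = coprime-divisor (coprime-/gcd (suc m) n) (subst (cofactor m n ∣_) (*-comm a d) c∣ad)
    where
    g = gcd (suc m) n
    d = n / g
    an≡adg : a * n ≡ a * d * g
    an≡adg = trans (cong (a *_) (sym n/gcd*gcd≡n)) (sym (*-assoc a d g))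
    c∣ad : cofactor m n ∣ a * d
    c∣ad = m∣n*o⇒m/n∣o (gcd[m,n]∣m (suc m) n) (subst (suc m ∣_) an≡adg 1+m∣an)

  odd-multiple⇒cofactor-multiple : ∀ {a K} → Odd K → a * n ≡ K * suc m → a ≤ m →
    ∃ λ ξ → Odd ξ × 1 ≤ ξ × ξ ≤ gcd (suc m) n × a ≡ cofactor m n * ξ
  odd-multiple⇒cofactor-multiple {a} {K} odd-K an≡KN a≤m with cofactor-∣ (divides K an≡KN)
  ... | divides ξ a≡ξc = ξ , odd-ξ , odd⇒1≤ odd-ξ , ξ≤g , trans a≡ξc (*-comm ξ c)
    where
    c = cofactor m n
    g = gcd (suc m) n
    d = n / g
    regroup : ∀ ξ d c g → ξ * d * (c * g) ≡ ξ * c * (d * g)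
    regroup = ℕ-Solver.solve-∀
    ξd≡K : ξ * d ≡ K
    ξd≡K = *-cancelʳ-≡ (ξ * d) K (suc m) (begin
      ξ * d * suc m     ≡⟨ cong (ξ * d *_) cofactor*gcd≡1+m ⟨
      ξ * d * (c * g)   ≡⟨ regroup ξ d c g ⟩
      ξ * c * (d * g)   ≡⟨ cong₂ _*_ (sym a≡ξc) n/gcd*gcd≡n ⟩
      a * n             ≡⟨ an≡KN ⟩
      K * suc m         ∎)
    odd-ξ : Odd ξ
    odd-ξ = odd-*⇒oddˡ ξ d (subst Odd (sym ξd≡K) odd-K)
    ξ≤g : ξ ≤ g
    ξ≤g = *-cancelʳ-≤ ξ g c (subst₂ _≤_ a≡ξc (trans (sym cofactor*gcd≡1+m) (*-comm c g)) (≤-trans a≤m (n≤1+n m)))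

  cofactor-multiple⇒periodic : ∀ u → Odd n → + (2 ^ suc u) ≡ + n ℤ.- + 1 ⊎ + (2 ^ suc u) ≡ + n ℤ.+ + 1 →
    ∀ {a ξ} → Odd ξ → a ≤ m → a ≡ cofactor m n * ξ → 1 ≤ a × iter (suc u) (f₂ m) a ≡ a
  cofactor-multiple⇒periodic u odd-n 2^t≡n∓1 {ξ = ξ} odd-ξ a≤m refl = 1≤a , (begin
    iter (suc u) (f₂ m) (c * ξ)  ≡⟨ iter-* {f₂ m} {f₂ m′} c (f₂-* {c = c} c*[1+m′]≡1+m) (suc u) ξ ⟩
    c * iter (suc u) (f₂ m′) ξ   ≡⟨ cong (c *_) (odd-fixed-point m′ u n (n / g) odd-n n≡d*[1+m′] 2^t≡n∓1 odd-ξ ξ≤m′) ⟩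
    c * ξ                        ∎)
    where
    c = cofactor m n
    g = gcd (suc m) n
    m′ = pred g
    c*[1+m′]≡1+m : c * suc m′ ≡ suc m
    c*[1+m′]≡1+m = trans (cong (c *_) (suc-pred g)) cofactor*gcd≡1+m
    n≡d*[1+m′] : n ≡ n / g * suc m′
    n≡d*[1+m′] = trans (sym n/gcd*gcd≡n) (cong (n / g *_) (sym (suc-pred g)))
    ξ≤m′ : ξ ≤ m′
    ξ≤m′ = ≤-pred (*-cancelˡ-< c ξ (suc m′) (subst (c * ξ <_) (sym c*[1+m′]≡1+m) (s≤s a≤m)))
    1≤a : 1 ≤ c * ξ
    1≤a = *-mono-≤ (>-nonZero⁻¹ c) (odd⇒1≤ odd-ξ)

theorem3p3p2 : (m t : ℕ) → m ≥ 2 → t ≥ 1 → (a : ℕ) →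
    ((1 ≤ a × a ≤ m) × iter t (f₂ m) a ≡ a)
    ⇔ (a ≤ m ×
        ((∃ λ ξ₁ → Odd ξ₁ × 1 ≤ ξ₁ × ξ₁ ≤ g₊ m t × a ≡ cofactor m (2 ^ t + 1) * ξ₁)
         ⊎ (∃ λ ξ₂ → Odd ξ₂ × 1 ≤ ξ₂ × ξ₂ ≤ g₋ m t × a ≡ cofactor m (2 ^ t ∸ 1) * ξ₂)))
theorem3p3p2 m zero _ () a
theorem3p3p2 m (suc u) _ _ a = mk⇔
  (λ ((1≤a , a≤m) , fix) → a≤m ,
    Sum.map (λ (K , odd-K , a*n≡KN) → odd-multiple⇒cofactor-multiple m _ odd-K a*n≡KN a≤m)
            (λ (K , odd-K , a*n≡KN) → odd-multiple⇒cofactor-multiple m _ odd-K a*n≡KN a≤m)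
            (periodic⇒odd-multiple m u a 1≤a fix))
  λ where
    (a≤m , inj₁ (ξ , odd-ξ , _ , _ , a≡cξ)) → reassociate a≤m
      (cofactor-multiple⇒periodic m (2 ^ suc u + 1) u (2 ^ u , refl)
        (inj₁ (+p≡+[p+1]-1 (2 ^ suc u))) odd-ξ a≤m a≡cξ)
    (a≤m , inj₂ (ξ , odd-ξ , _ , _ , a≡cξ)) → reassociate a≤m
      (cofactor-multiple⇒periodic m (2 ^ suc u ∸ 1) u (odd-2k∸1 (m^n>0 2 u))
        (inj₂ (+p≡+[p∸1]+1 (m^n>0 2 (suc u)))) odd-ξ a≤m a≡cξ)
  where
  reassociate : ∀ {A B C : Set} → B → A × C → (A × B) × C
  reassociate b (a , c) = (a , b) , c
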